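{- Let $D$ be a filling of the squares $(r,c)$, $r,c\geq1$, with finitely many cross tiles and otherwise elbow tiles, except that the square $(a,b)$ is left empty. Let $N,S,E,W$ denote the four pipe segments leaving the square $(a,b)$ through its North, South, East, West edges respectively (followed until they leave the quadrant), and call all other pipes "old pipes". Let $D_{\mathrm{el}}$ and $D_{+}$ denote $D$ with an elbow tile, respectively a cross tile, placed at $(a,b)$; thus $D_{\mathrm{el}}$ has new pipes $WN$ and $ES$, and $D_+$ has new pipes $NS$ and $EW$. Assume: (1) every square lying West of the pipe $E$, other than $(a,b)$ itself, holds a cross tile (so in particular $N$ and $W$ are straight). Then if $D_{\mathrm{el}}$ is a pipe dream, so is $D_+$. If in addition (2) no old pipe has its North end strictly between the North ends of $N$ and $E$ while also having its West end strictly between the West ends of $W$ and $S$, then $D_+$ being a pipe dream implies that $D_{\mathrm{el}}$ is a pipe dream.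
   Context: Squares are indexed by matrix coordinates $(r,c)$ (row $r$, column $c$). An elbow tile joins its North edge to its West edge and its South edge to its East edge; a cross tile joins North to South and East to West. Pipes run from the top edge of the quadrant to the left edge. A pipe dream is such a filling (with no empty squares) in which no two pipes cross each other more than once. -}

module Defs where

open import Data.Nat using (ℕ; zero; suc; pred; _<_; _≤_; _≡ᵇ_)
open import Data.Empty using (⊥)
open import Data.Bool using (if_then_else_; _∧_)
open import Data.Product using (_×_; _,_; ∃-syntax; Σ-syntax)
open import Data.Sum using (_⊎_)
open import Relation.Nullary using (¬_)
open import Relation.Binary.PropositionalEquality using (_≡_; _≢_)
open import Relation.Binary.Construct.Closure.ReflexiveTransitive using (Star)

-- Squares are (r , c) with r , c ≥ 1 (matrix coordinates, 1-based).
-- Column 0 is used only as the "outside, to the left" position.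
data Tile : Set where
  elbow cross empty : Tile

-- A filling assigns a tile to every square; values at r = 0 or c = 0 are irrelevant.
Filling : Set
Filling = ℕ → ℕ → Tile

-- Edge through which a pipe (travelling from the top edge towards the
-- left edge, i.e. moving South/West) enters a square.
data Dir : Set where
  inN inE : Dir

-- The state  st r 0 inE  means the pipe has left the quadrant through
-- the West edge of square (r , 1), i.e. its West end is row r.
data State : Set where
  st : ℕ → ℕ → Dir → State

-- One step of a pipe.  Elbow: N ↔ W, S ↔ E.  Cross: N ↔ S, E ↔ W.
-- No step out of an empty square, and none out of column 0 (outside).
data Step (F : Filling) : State → State → Set where
  elN : ∀ {r c} → F r (suc c) ≡ elbow → Step F (st r (suc c) inN) (st r c inE)
  elE : ∀ {r c} → F r (suc c) ≡ elbow → Step F (st r (suc c) inE) (st (suc r) (suc c) inN)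
  crN : ∀ {r c} → F r (suc c) ≡ cross → Step F (st r (suc c) inN) (st (suc r) (suc c) inN)
  crE : ∀ {r c} → F r (suc c) ≡ cross → Step F (st r (suc c) inE) (st r c inE)

Reach : Filling → State → State → Set
Reach F = Star (Step F)

-- The pipe whose North end is column (suc k) starts here.
top : ℕ → State
top k = st 1 (suc k) inN

update : Filling → ℕ → ℕ → Tile → Filling
update F a b t r c = if (r ≡ᵇ a) ∧ (c ≡ᵇ b) then t else F r c

FinitelyManyCrosses : Filling → Set
FinitelyManyCrosses F =
  ∃[ n ] (∀ r c → 1 ≤ r → 1 ≤ c → F r c ≡ cross → r < n × c < n)

CrossVH : Filling → ℕ → ℕ → ℕ → ℕ → Set
CrossVH F p q r c =
  F r c ≡ cross × Reach F (top p) (st r c inN) × Reach F (top q) (st r c inE)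

CrossAt : Filling → ℕ → ℕ → ℕ × ℕ → Set
CrossAt F p q (r , c) = CrossVH F p q r c ⊎ CrossVH F q p r c

PipeDream : Filling → Set
PipeDream F =
  (∀ r c → 1 ≤ r → 1 ≤ c → F r c ≢ empty) ×
  FinitelyManyCrosses F ×
  (∀ p q s s' → CrossAt F p q s → CrossAt F p q s' → s ≡ s')

EmptyAt : Filling → ℕ → ℕ → Set
EmptyAt D a b =
  1 ≤ a × 1 ≤ b × D a b ≡ empty ×
  (∀ r c → 1 ≤ r → 1 ≤ c → D r c ≡ empty → r ≡ a × c ≡ b) ×
  FinitelyManyCrosses D

OnE : Filling → ℕ → ℕ → ℕ → ℕ → Set
OnE D a b r c =
  ∃[ k ] ∃[ d ] (Reach D (top k) (st r c d) × Reach D (st r c d) (st a b inE)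
                 × ¬ (r ≡ a × c ≡ b))

WestOfE : Filling → ℕ → ℕ → ℕ → ℕ → Set
WestOfE D a b r c =
  1 ≤ c × (∃[ c' ] OnE D a b r c') × (∀ c' → OnE D a b r c' → c < c')

Hyp1 : Filling → ℕ → ℕ → Set
Hyp1 D a b = ∀ r c → WestOfE D a b r c → ¬ (r ≡ a × c ≡ b) → D r c ≡ cross

Between : ℕ → ℕ → ℕ → Set
Between x y z = (x < y × y < z) ⊎ (z < y × y < x)

-- North ends: N starts at column nN, E at column nE;
-- West ends: W ends at row wW, S at row wS.  An old pipe (North end
-- column suc k) is a pipe of D reaching the left edge (hence avoiding (a , b)).
Hyp2 : Filling → ℕ → ℕ → Set
Hyp2 D a b =
  ∀ nN nE wW wS k r →
  Reach D (st 1 nN inN) (st a b inN) →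
  Reach D (st 1 nE inN) (st a b inE) →
  Reach D (st a (pred b) inE) (st wW 0 inE) →
  Reach D (st (suc a) b inN) (st wS 0 inE) →
  Reach D (top k) (st r 0 inE) →
  Between nN (suc k) nE → Between wW r wS → ⊥

-- Hypothesis (1) fills the rectangle [1, a] × [1, b] minus (a, b) with crosses, so N runs straight
-- down column b and W straight along row a. Changing the tile at (a, b) only reconnects N, E, W, S,
-- so a crossing away from (a, b) in one filling is a crossing of the same two segments in the other,
-- and a pipe of one filling is matched with the pipe of the other through the segment that carries the
-- crossing. This matching is consistent because no two pipes cross both before and after the hole.
-- For D₊ that follows from the rows of crosses above (a, b); for D_el, a pipe crossing both E and S
-- would, since a single crossing reverses the order in which two pipes reach the left edge, have its
-- ends in the positions forbidden by (2). The crossing of NS and EW at (a, b) in D₊ is their only one.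
module Submission where

open import Defs
open import Data.Nat using (ℕ; zero; suc; _<_; _≤_; _≡ᵇ_; _≟_; z≤n; s≤s; _+_)
open import Data.Nat.Properties
open import Data.Empty using (⊥; ⊥-elim)
open import Data.Bool using (true; false; T)
open import Data.Product using (_×_; _,_; ∃-syntax; proj₁; proj₂)
open import Data.Unit using (tt)
open import Data.Sum using (_⊎_; inj₁; inj₂)
open import Relation.Nullary using (¬_; yes; no)
open import Relation.Binary.PropositionalEquality
open import Relation.Binary.Construct.Closure.ReflexiveTransitive using (ε; _◅_; _◅◅_)
open import Relation.Binary.Definitions using (tri<; tri≈; tri>)
open import Data.Nat.Tactic.RingSolver using (solve-∀)

row col : State → ℕ
row (st r _ _) = r
col (st _ c _) = c

dir : State → Dir
dir (st _ _ d) = d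

elbow≢cross : elbow ≢ cross
elbow≢cross ()

elbow≢empty : elbow ≢ empty
elbow≢empty ()

cross≢empty : cross ≢ empty
cross≢empty ()

inN≢inE : inN ≢ inE
inN≢inE ()

module Geometry (F : Filling) where

  step-advances : ∀ {x y} → Step F x y →
                  (row x < row y × col y ≡ col x) ⊎ (row y ≡ row x × col y < col x)
  step-advances (elN _) = inj₂ (refl , ≤-refl)
  step-advances (elE _) = inj₁ (≤-refl , refl)
  step-advances (crN _) = inj₁ (≤-refl , refl)
  step-advances (crE _) = inj₂ (refl , ≤-refl)

  reach-monotone : ∀ {x y} → Reach F x y → row x ≤ row y × col y ≤ col x
  reach-monotone ε = ≤-refl , ≤-refl
  reach-monotone {x} {y} (s ◅ p) with step-advances s | reach-monotone p
  ... | inj₁ (lt , eq) | (r≤ , c≥) = ≤-trans (<⇒≤ lt) r≤ , subst (col y ≤_) eq c≥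
  ... | inj₂ (eq , lt) | (r≤ , c≥) = subst (_≤ row y) eq r≤ , ≤-trans c≥ (<⇒≤ lt)

  row-mono : ∀ {x y} → Reach F x y → row x ≤ row y
  row-mono p = proj₁ (reach-monotone p)

  col-antitone : ∀ {x y} → Reach F x y → col y ≤ col x
  col-antitone p = proj₂ (reach-monotone p)

  step-deterministic : ∀ {x y z} → Step F x y → Step F x z → y ≡ z
  step-deterministic (elN _) (elN _) = refl
  step-deterministic (elN e) (crN e') = ⊥-elim (elbow≢cross (trans (sym e) e'))
  step-deterministic (elE _) (elE _) = refl
  step-deterministic (elE e) (crE e') = ⊥-elim (elbow≢cross (trans (sym e) e'))
  step-deterministic (crN e) (elN e') = ⊥-elim (elbow≢cross (trans (sym e') e))
  step-deterministic (crN _) (crN _) = refl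
  step-deterministic (crE e) (elE e') = ⊥-elim (elbow≢cross (trans (sym e') e))
  step-deterministic (crE _) (crE _) = refl

  reach-total : ∀ {s x y} → Reach F s x → Reach F s y → Reach F x y ⊎ Reach F y x
  reach-total ε q = inj₁ q
  reach-total (s ◅ p) ε = inj₂ (s ◅ p)
  reach-total (s₁ ◅ p) (s₂ ◅ q) with step-deterministic s₁ s₂
  ... | refl = reach-total p q

  reach-same-square : ∀ {x y} → Reach F x y → row x ≡ row y → col x ≡ col y → x ≡ y
  reach-same-square ε _ _ = refl
  reach-same-square (s ◅ p) er ec with step-advances s | reach-monotone p
  ... | inj₁ (lt , _) | (r≤ , _) = ⊥-elim (<-irrefl er (≤-trans lt r≤))
  ... | inj₂ (_ , lt) | (_ , c≥) = ⊥-elim (<-irrefl (sym ec) (≤-trans (s≤s c≥) lt))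

  same-square-same-dir : ∀ {s r c d₁ d₂} → Reach F s (st r c d₁) → Reach F s (st r c d₂) → d₁ ≡ d₂
  same-square-same-dir p q with reach-total p q
  ... | inj₁ z = cong dir (reach-same-square z refl refl)
  ... | inj₂ z = cong dir (sym (reach-same-square z refl refl))

  reach-same-col : ∀ {x y} → Reach F x y → col x ≡ col y → x ≡ y ⊎ dir y ≡ inN
  reach-same-col ε _ = inj₁ refl
  reach-same-col (elN _ ◅ p) e = ⊥-elim (<-irrefl (sym e) (s≤s (col-antitone p)))
  reach-same-col (crE _ ◅ p) e = ⊥-elim (<-irrefl (sym e) (s≤s (col-antitone p)))
  reach-same-col (elE _ ◅ p) e with reach-same-col p e
  ... | inj₁ refl = inj₂ refl
  ... | inj₂ d = inj₂ d
  reach-same-col (crN _ ◅ p) e with reach-same-col p e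
  ... | inj₁ refl = inj₂ refl
  ... | inj₂ d = inj₂ d

  same-row-inN : ∀ {x y} → Reach F x y → row x ≡ row y → dir y ≡ inN → x ≡ y
  same-row-inN ε _ _ = refl
  same-row-inN (elN _ ◅ p) e d with same-row-inN p e d
  ... | refl = ⊥-elim (inN≢inE (sym d))
  same-row-inN (crE _ ◅ p) e d with same-row-inN p e d
  ... | refl = ⊥-elim (inN≢inE (sym d))
  same-row-inN (elE _ ◅ p) e d = ⊥-elim (<-irrefl e (row-mono p))
  same-row-inN (crN _ ◅ p) e d = ⊥-elim (<-irrefl e (row-mono p))

  reach-crosses-col : ∀ {x y} j → Reach F x y → col y ≤ j → j < col x →
                      ∃[ r ] Reach F x (st r j inE) × Reach F (st r j inE) y
  reach-crosses-col j ε le lt = ⊥-elim (<-irrefl refl (≤-<-trans le lt))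
  reach-crosses-col j (elN {r} e ◅ p) le lt with m≤n⇒m<n∨m≡n (≤-pred lt)
  ... | inj₂ refl = r , elN e ◅ ε , p
  ... | inj₁ lt′ with reach-crosses-col j p le lt′
  ...   | r′ , p₁ , p₂ = r′ , elN e ◅ p₁ , p₂
  reach-crosses-col j (crE {r} e ◅ p) le lt with m≤n⇒m<n∨m≡n (≤-pred lt)
  ... | inj₂ refl = r , crE e ◅ ε , p
  ... | inj₁ lt′ with reach-crosses-col j p le lt′
  ...   | r′ , p₁ , p₂ = r′ , crE e ◅ p₁ , p₂
  reach-crosses-col j (elE e ◅ p) le lt with reach-crosses-col j p le lt
  ... | r′ , p₁ , p₂ = r′ , elE e ◅ p₁ , p₂
  reach-crosses-col j (crN e ◅ p) le lt with reach-crosses-col j p le lt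
  ... | r′ , p₁ , p₂ = r′ , crN e ◅ p₁ , p₂

  reach-enters-row : ∀ {x y} r → Reach F x y → row x < r → r ≤ row y →
                     ∃[ m ] Reach F x m × Reach F m y × row m ≡ r × dir m ≡ inN
  reach-enters-row r ε lt le = ⊥-elim (<-irrefl refl (<-≤-trans lt le))
  reach-enters-row r (elN e ◅ p) lt le with reach-enters-row r p lt le
  ... | m , p₁ , p₂ , h = m , elN e ◅ p₁ , p₂ , h
  reach-enters-row r (crE e ◅ p) lt le with reach-enters-row r p lt le
  ... | m , p₁ , p₂ , h = m , crE e ◅ p₁ , p₂ , h
  reach-enters-row r (elE e ◅ p) lt le with m≤n⇒m<n∨m≡n lt
  ... | inj₂ refl = _ , elE e ◅ ε , p , refl , refl
  ... | inj₁ lt′ with reach-enters-row r p lt′ le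
  ...   | m , p₁ , p₂ , h = m , elE e ◅ p₁ , p₂ , h
  reach-enters-row r (crN e ◅ p) lt le with m≤n⇒m<n∨m≡n lt
  ... | inj₂ refl = _ , crN e ◅ ε , p , refl , refl
  ... | inj₁ lt′ with reach-enters-row r p lt′ le
  ...   | m , p₁ , p₂ , h = m , crN e ◅ p₁ , p₂ , h

  CrossRow : ℕ → ℕ → Set
  CrossRow r c = ∀ j → 1 ≤ j → j ≤ c → F r j ≡ cross

  cross-row-straight : ∀ {r c y} → CrossRow r c → Reach F (st r c inE) y → ∃[ j ] y ≡ st r j inE
  cross-row-straight {c = c} h ε = c , refl
  cross-row-straight h (elE e ◅ p) = ⊥-elim (elbow≢cross (trans (sym e) (h _ (s≤s z≤n) ≤-refl)))
  cross-row-straight h (crE e ◅ p) = cross-row-straight (λ j o le → h j o (m≤n⇒m≤1+n le)) p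

  cross-row-no-descent : ∀ {r c s w} → CrossRow r c → Reach F s (st r c inE) → Reach F s w → ¬ (r < row w)
  cross-row-no-descent h p q lt with reach-total p q
  ... | inj₂ q′ = <-irrefl refl (<-≤-trans lt (row-mono q′))
  ... | inj₁ q′ with cross-row-straight h q′
  ...   | _ , refl = <-irrefl refl lt

  exit-final : ∀ {w d y} → Reach F (st w 0 d) y → y ≡ st w 0 d
  exit-final ε = refl
  exit-final (() ◅ _)

  reach-exit-from : ∀ {s x w} → Reach F s x → Reach F s (st w 0 inE) → Reach F x (st w 0 inE)
  reach-exit-from p q with reach-total p q
  ... | inj₁ r = r
  ... | inj₂ r with exit-final r
  ...   | refl = ε

  step-col-pos : ∀ {x y} → Step F x y → 1 ≤ col x
  step-col-pos (elN _) = s≤s z≤n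
  step-col-pos (elE _) = s≤s z≤n
  step-col-pos (crN _) = s≤s z≤n
  step-col-pos (crE _) = s≤s z≤n

  top-inN-col-pos : ∀ {k r c} → Reach F (top k) (st r c inN) → 1 ≤ c
  top-inN-col-pos p = go p (λ _ → s≤s z≤n) refl
    where
    go : ∀ {x y} → Reach F x y → (dir x ≡ inN → 1 ≤ col x) → dir y ≡ inN → 1 ≤ col y
    go ε h d = h d
    go (elN _ ◅ p) h d = go p (λ ()) d
    go (elE _ ◅ p) h d = go p (λ _ → s≤s z≤n) d
    go (crN _ ◅ p) h d = go p (λ _ → s≤s z≤n) d
    go (crE _ ◅ p) h d = go p (λ ()) d

module Tracing (F : Filling) (n : ℕ)
  (bounded : ∀ r c → 1 ≤ r → 1 ≤ c → F r c ≡ cross → r < n × c < n) where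

  EmptySquare : ℕ → ℕ → Set
  EmptySquare r c = 1 ≤ r × 1 ≤ c × F r c ≡ empty

  Stuck : State → Set
  Stuck y = (∃[ w ] y ≡ st w 0 inE) ⊎ (∃[ r ] ∃[ c ] ∃[ d ] y ≡ st r c d × EmptySquare r c)

  mutual
    -- No cross lies in a row ≥ n, so the fuel f with n ≤ r + f outlasts any run of crosses going South.
    trace-N : ∀ r c f → 1 ≤ r → n ≤ r + f → ∃[ y ] Reach F (st r (suc c) inN) y × Stuck y
    trace-N r c f o le with F r (suc c) in eq
    ... | elbow with trace-E r c o
    ...   | y , p , s = y , elN eq ◅ p , s
    trace-N r c zero o le | cross =
      ⊥-elim (<-irrefl refl (<-≤-trans (proj₁ (bounded r (suc c) o (s≤s z≤n) eq)) (subst (n ≤_) (+-identityʳ r) le)))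
    trace-N r c (suc f) o le | cross with trace-N (suc r) c f (m≤n⇒m≤1+n o) (subst (n ≤_) (+-suc r f) le)
    ... | y , p , s = y , crN eq ◅ p , s
    trace-N r c f o le | empty = _ , ε , inj₂ (r , suc c , inN , refl , o , s≤s z≤n , eq)

    trace-E : ∀ r c → 1 ≤ r → ∃[ y ] Reach F (st r c inE) y × Stuck y
    trace-E r zero o = _ , ε , inj₁ (r , refl)
    trace-E r (suc c) o with F r (suc c) in eq
    ... | elbow with trace-N (suc r) c n (m≤n⇒m≤1+n o) (m≤n+m n (suc r))
    ...   | y , p , s = y , elE eq ◅ p , s
    trace-E r (suc c) o | cross with trace-E r c o
    ... | y , p , s = y , crE eq ◅ p , s
    trace-E r (suc c) o | empty = _ , ε , inj₂ (r , suc c , inE , refl , o , s≤s z≤n , eq)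

  trace-top : ∀ k → ∃[ y ] Reach F (top k) y × Stuck y
  trace-top k = trace-N 1 k n ≤-refl (m≤n+m n 1)

  module Backwards (b : ℕ) where

    FromTopOrEmptyEast : State → Set
    FromTopOrEmptyEast x = (∃[ k ] Reach F (top k) x) ⊎ (∃[ r ] ∃[ c ] b < c × EmptySquare r c)

    mutual
      trace-back-N : ∀ r c → b < c → FromTopOrEmptyEast (st (suc r) c inN)
      trace-back-N zero (suc k) lt = inj₁ (k , ε)
      trace-back-N (suc r) (suc c) lt with F (suc r) (suc c) in eq
      ... | elbow with trace-back-E r (suc c) n (<⇒≤ lt) (m≤n+m n (suc c))
      ...   | inj₁ (k , p) = inj₁ (k , p ◅◅ (elE eq ◅ ε))
      ...   | inj₂ z = inj₂ z
      trace-back-N (suc r) (suc c) lt | cross with trace-back-N r (suc c) lt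
      ... | inj₁ (k , p) = inj₁ (k , p ◅◅ (crN eq ◅ ε))
      ... | inj₂ z = inj₂ z
      trace-back-N (suc r) (suc c) lt | empty = inj₂ (suc r , suc c , lt , s≤s z≤n , s≤s z≤n , eq)

      -- No cross lies in a column ≥ n, so the fuel f with n ≤ c + f outlasts any run of crosses going East.
      trace-back-E : ∀ r c f → b ≤ c → n ≤ c + f → FromTopOrEmptyEast (st (suc r) c inE)
      trace-back-E r c f le nf with F (suc r) (suc c) in eq
      ... | elbow with trace-back-N r (suc c) (s≤s le)
      ...   | inj₁ (k , p) = inj₁ (k , p ◅◅ (elN eq ◅ ε))
      ...   | inj₂ z = inj₂ z
      trace-back-E r c zero le nf | cross =
        ⊥-elim (<-irrefl refl (≤-trans (proj₂ (bounded (suc r) (suc c) (s≤s z≤n) (s≤s z≤n) eq))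
                                       (≤-trans (subst (n ≤_) (+-identityʳ c) nf) (n≤1+n c))))
      trace-back-E r c (suc f) le nf | cross with trace-back-E r (suc c) f (m≤n⇒m≤1+n le) (subst (n ≤_) (+-suc c f) nf)
      ... | inj₁ (k , p) = inj₁ (k , p ◅◅ (crE eq ◅ ε))
      ... | inj₂ z = inj₂ z
      trace-back-E r c f le nf | empty = inj₂ (suc r , suc c , s≤s le , s≤s z≤n , s≤s z≤n , eq)

-- Each step raises row − col by one. These lemmas compare such differences in the form
-- r + c′ ≤ r′ + c, which avoids truncated subtraction.
private
  shift-≤ : ∀ rx cx rx′ cx′ ry cy → rx′ + cx ≡ suc (rx + cx′) → rx′ + cy ≤ ry + cx′ →
            suc (rx + cy) ≤ ry + cx
  shift-≤ rx cx rx′ cx′ ry cy e h = +-cancelʳ-≤ cx′ _ _ (begin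
      suc (rx + cy) + cx′  ≡⟨ swap₁ rx cy cx′ ⟩
      suc (rx + cx′) + cy  ≡⟨ cong (_+ cy) (sym e) ⟩
      (rx′ + cx) + cy      ≡⟨ swap₂ rx′ cx cy ⟩
      (rx′ + cy) + cx      ≤⟨ +-monoˡ-≤ cx h ⟩
      (ry + cx′) + cx      ≡⟨ swap₂ ry cx′ cx ⟩
      (ry + cx) + cx′      ∎)
    where
    open ≤-Reasoning
    swap₁ : ∀ a b c → suc (a + b) + c ≡ suc (a + c) + b
    swap₁ = solve-∀
    swap₂ : ∀ a b c → (a + b) + c ≡ (a + c) + b
    swap₂ = solve-∀

  unshift-≤ : ∀ ra ca ra′ ca′ rt ct → ra′ + ca ≡ suc (ra + ca′) → suc (ra + ct) ≤ rt + ca →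
              ra′ + ct ≤ rt + ca′
  unshift-≤ ra ca ra′ ca′ rt ct e h = +-cancelʳ-≤ ca _ _ (begin
      (ra′ + ct) + ca      ≡⟨ swap₂ ra′ ct ca ⟩
      (ra′ + ca) + ct      ≡⟨ cong (_+ ct) e ⟩
      suc (ra + ca′) + ct  ≡⟨ swap₁ ra ca′ ct ⟩
      suc (ra + ct) + ca′  ≤⟨ +-monoˡ-≤ ca′ h ⟩
      (rt + ca) + ca′      ≡⟨ swap₂ rt ca ca′ ⟩
      (rt + ca′) + ca      ∎)
    where
    open ≤-Reasoning
    swap₁ : ∀ a b c → suc (a + b) + c ≡ suc (a + c) + b
    swap₁ = solve-∀
    swap₂ : ∀ a b c → (a + b) + c ≡ (a + c) + b
    swap₂ = solve-∀

  shift-≡ : ∀ rx cx rx′ cx′ ry cy ry′ cy′ → rx′ + cx ≡ suc (rx + cx′) → ry′ + cy ≡ suc (ry + cy′) →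
            rx + cy ≡ ry + cx → rx′ + cy′ ≡ ry′ + cx′
  shift-≡ rx cx rx′ cx′ ry cy ry′ cy′ e₁ e₂ h = +-cancelʳ-≡ (cx + cy) _ _ (begin
      (rx′ + cy′) + (cx + cy)       ≡⟨ q₁ rx′ cy′ cx cy ⟩
      (rx′ + cx) + (cy + cy′)       ≡⟨ cong (_+ (cy + cy′)) e₁ ⟩
      suc (rx + cx′) + (cy + cy′)   ≡⟨ q₂ rx cx′ cy cy′ ⟩
      suc (rx + cy) + (cx′ + cy′)   ≡⟨ cong (λ z → suc z + (cx′ + cy′)) h ⟩
      suc (ry + cx) + (cx′ + cy′)   ≡⟨ q₃ ry cx cx′ cy′ ⟩
      suc (ry + cy′) + (cx + cx′)   ≡⟨ cong (_+ (cx + cx′)) (sym e₂) ⟩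
      (ry′ + cy) + (cx + cx′)       ≡⟨ q₄ ry′ cy cx cx′ ⟩
      (ry′ + cx′) + (cx + cy)       ∎)
    where
    open ≡-Reasoning
    q₁ : ∀ a b c d → (a + b) + (c + d) ≡ (a + c) + (d + b)
    q₁ = solve-∀
    q₂ : ∀ a b c d → suc (a + b) + (c + d) ≡ suc (a + c) + (b + d)
    q₂ = solve-∀
    q₃ : ∀ a b c d → suc (a + b) + (c + d) ≡ suc (a + d) + (b + c)
    q₃ = solve-∀
    q₄ : ∀ a b c d → (a + b) + (c + d) ≡ (a + d) + (c + b)
    q₄ = solve-∀

  shift-trans : ∀ ra ca rb cb rc cc → ra + cb ≡ rb + ca → rb + cc ≡ rc + cb → ra + cc ≡ rc + ca
  shift-trans ra ca rb cb rc cc h₁ h₂ = +-cancelʳ-≡ cb _ _ (begin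
      (ra + cc) + cb  ≡⟨ swap ra cc cb ⟩
      (ra + cb) + cc  ≡⟨ cong (_+ cc) h₁ ⟩
      (rb + ca) + cc  ≡⟨ swap rb ca cc ⟩
      (rb + cc) + ca  ≡⟨ cong (_+ ca) h₂ ⟩
      (rc + cb) + ca  ≡⟨ swap rc cb ca ⟩
      (rc + ca) + cb  ∎)
    where
    open ≡-Reasoning
    swap : ∀ a b c → (a + b) + c ≡ (a + c) + b
    swap = solve-∀

  double-< : ∀ {m n} → m < n → suc (suc (m + m)) ≤ n + n
  double-< {m} {n} lt = subst (_≤ n + n) (+-suc (suc m) m) (+-mono-≤ lt lt)

data SameTime (x y : State) : Set where
  same-time : row x + col y ≡ row y + col x → SameTime x y

SameTime-sym : ∀ {x y} → SameTime x y → SameTime y x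
SameTime-sym (same-time h) = same-time (sym h)

SameTime-trans : ∀ {x y z} → SameTime x y → SameTime y z → SameTime x z
SameTime-trans {st ra ca _} {st rb cb _} {st rc cc _} (same-time h₁) (same-time h₂) =
  same-time (shift-trans ra ca rb cb rc cc h₁ h₂)

-- States with equal row − col lie on one anti-diagonal, which slot orders from South-West to North-East.
slot : State → ℕ
slot (st _ c inN) = c + c
slot (st _ c inE) = suc (c + c)

slot-lower : ∀ x → col x + col x ≤ slot x
slot-lower (st _ c inN) = ≤-refl
slot-lower (st _ c inE) = n≤1+n _

slot-upper : ∀ x → slot x ≤ suc (col x + col x)
slot-upper (st _ c inN) = n≤1+n _
slot-upper (st _ c inE) = ≤-refl

module Timing (F : Filling) where
  open Geometry F

  time-step : ∀ {x y} → Step F x y → row y + col x ≡ suc (row x + col y)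
  time-step (elN {r} {c} _) = +-suc r c
  time-step (elE _) = refl
  time-step (crN _) = refl
  time-step (crE {r} {c} _) = +-suc r c

  time-strict : ∀ {x x′ y} → Step F x x′ → Reach F x′ y → suc (row x + col y) ≤ row y + col x
  time-mono : ∀ {x y} → Reach F x y → row x + col y ≤ row y + col x
  time-strict {st rx cx _} {st rx′ cx′ _} {st ry cy _} s p = shift-≤ rx cx rx′ cx′ ry cy (time-step s) (time-mono p)
  time-mono ε = ≤-refl
  time-mono (s ◅ p) = <⇒≤ (time-strict s p)

  same-time-reach : ∀ {y z} → Reach F y z → SameTime y z → y ≡ z
  same-time-reach ε _ = refl
  same-time-reach (s ◅ p) (same-time e) = ⊥-elim (<-irrefl e (time-strict s p))

  same-time-step : ∀ {x x′ y y′} → Step F x x′ → Step F y y′ → SameTime x y → SameTime x′ y′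
  same-time-step {st rx cx _} {st rx′ cx′ _} {st ry cy _} {st ry′ cy′ _} s₁ s₂ (same-time h) =
    same-time (shift-≡ rx cx rx′ cx′ ry cy ry′ cy′ (time-step s₁) (time-step s₂) h)

  slot-step : ∀ {x x′} → Step F x x′ → slot x′ ≤ col x + col x × col x + col x ≤ suc (slot x′)
  slot-step (elN {c = c} _) = s≤s (subst (c + c ≤_) (sym (+-suc c c)) (n≤1+n _)) , s≤s (≤-reflexive (+-suc c c))
  slot-step (elE _) = ≤-refl , n≤1+n _
  slot-step (crN _) = ≤-refl , n≤1+n _
  slot-step (crE {c = c} _) = s≤s (subst (c + c ≤_) (sym (+-suc c c)) (n≤1+n _)) , s≤s (≤-reflexive (+-suc c c))

  ordered-same-col : ∀ {x y} → SameTime x y → col x ≡ col y → slot x < slot y →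
                     ∃[ r ] ∃[ c ] x ≡ st r c inN × y ≡ st r c inE
  ordered-same-col {st r₁ c inN} {st r₂ .c inN} h refl lt = ⊥-elim (<-irrefl refl lt)
  ordered-same-col {st r₁ c inN} {st r₂ .c inE} (same-time h) refl lt with +-cancelʳ-≡ c r₁ r₂ h
  ... | refl = r₁ , c , refl , refl
  ordered-same-col {st r₁ c inE} {st r₂ .c inN} h refl lt = ⊥-elim (<-irrefl refl (<-trans lt (n<1+n _)))
  ordered-same-col {st r₁ c inE} {st r₂ .c inE} h refl lt = ⊥-elim (<-irrefl refl lt)

  both-edges-step : ∀ {r c x′ y′} → Step F (st r c inN) x′ → Step F (st r c inE) y′ →
                    (SameTime x′ y′ × slot x′ < slot y′) ⊎ F r c ≡ cross
  both-edges-step (elN {r} {c} _) (elE _) = inj₁ (same-time (+-suc r c) , s≤s (≤-reflexive (sym (+-suc c c))))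
  both-edges-step (elN e₁) (crE e₂) = ⊥-elim (elbow≢cross (trans (sym e₁) e₂))
  both-edges-step (crN e₁) (elE e₂) = ⊥-elim (elbow≢cross (trans (sym e₂) e₁))
  both-edges-step (crN e₁) (crE _) = inj₂ e₁

  ordered-step : ∀ {x x′ y y′} → SameTime x y → slot x < slot y → Step F x x′ → Step F y y′ →
                 (SameTime x′ y′ × slot x′ < slot y′) ⊎
                 (∃[ r ] ∃[ c ] x ≡ st r c inN × y ≡ st r c inE × F r c ≡ cross)
  ordered-step {x} {x′} {y} {y′} h lt s₁ s₂ with <-cmp (col x) (col y)
  ... | tri< c< _ _ = inj₁ (same-time-step s₁ s₂ h ,
        ≤-trans (s≤s (proj₁ (slot-step s₁))) (≤-pred (≤-trans (double-< c<) (proj₂ (slot-step s₂)))))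
  ... | tri> _ _ c> =
    ⊥-elim (<-irrefl refl (<-trans lt (≤-trans (s≤s (slot-upper y)) (≤-trans (double-< c>) (slot-lower x)))))
  ... | tri≈ _ c≡ _ with ordered-same-col h c≡ lt
  ...   | r , c , refl , refl with both-edges-step s₁ s₂
  ...     | inj₁ z = inj₁ z
  ...     | inj₂ e = inj₂ (r , c , refl , refl , e)

  ordered-until : ∀ u v {x y x′ y′} → Reach F (top u) x → Reach F (top v) y → Reach F x x′ → Reach F y y′ →
                  SameTime x y → SameTime x′ y′ → slot x < slot y →
                  slot x′ < slot y′ ⊎ ∃[ r ] ∃[ c ] CrossVH F u v r c
  ordered-until u v tx ty ε py h h′ lt with same-time-reach py (SameTime-trans (SameTime-sym h) h′)
  ... | refl = inj₁ lt
  ordered-until u v tx ty (sx ◅ px) ε h h′ lt with SameTime-trans h (SameTime-sym h′)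
  ... | same-time e = ⊥-elim (<-irrefl e (time-strict sx px))
  ordered-until u v tx ty (sx ◅ px) (sy ◅ py) h h′ lt with ordered-step h lt sx sy
  ... | inj₁ (h″ , lt′) = ordered-until u v (tx ◅◅ (sx ◅ ε)) (ty ◅◅ (sy ◅ ε)) px py h″ h′ lt′
  ... | inj₂ (r , c , refl , refl , e) = inj₂ (r , c , e , tx , ty)

  ordered-until-exit : ∀ u v {x y wx wy} → Reach F (top u) x → Reach F (top v) y →
                       Reach F x (st wx 0 inE) → Reach F y (st wy 0 inE) → SameTime x y → slot x < slot y →
                       wx < wy ⊎ ∃[ r ] ∃[ c ] CrossVH F u v r c × Reach F x (st r c inN)
  ordered-until-exit u v {y = st ry zero inN} tx ty ε py h ()
  ordered-until-exit u v {y = st ry zero inE} tx ty ε py h (s≤s ())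
  ordered-until-exit u v {y = st ry (suc cy) d} {wx} {wy} tx ty ε py (same-time h) lt =
    inj₁ (<-≤-trans wx<ry (row-mono py))
    where
    wx<ry : wx < ry
    wx<ry = ≤-trans (s≤s (m≤m+n wx cy)) (≤-reflexive (trans (sym (+-suc wx cy)) (trans h (+-identityʳ ry))))
  ordered-until-exit u v {x} tx ty (sx ◅ px) ε h lt =
    ⊥-elim (<-irrefl refl (≤-trans (s≤s 1≤slot) lt))
    where
    1≤slot : 1 ≤ slot x
    1≤slot = ≤-trans (step-col-pos sx) (≤-trans (m≤m+n (col x) (col x)) (slot-lower x))
  ordered-until-exit u v tx ty (sx ◅ px) (sy ◅ py) h lt with ordered-step h lt sx sy
  ... | inj₂ (r , c , refl , refl , e) = inj₂ (r , c , (e , tx , ty) , ε)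
  ... | inj₁ (h′ , lt′) with ordered-until-exit u v (tx ◅◅ (sx ◅ ε)) (ty ◅◅ (sy ◅ ε)) px py h′ lt′
  ...   | inj₁ z = inj₁ z
  ...   | inj₂ (r , c , cr , q) = inj₂ (r , c , cr , sx ◅ q)

  reach-meets-time : ∀ {x y t} → Reach F x y → row x + col t ≤ row t + col x → row t + col y ≤ row y + col t →
                     ∃[ m ] Reach F x m × Reach F m y × SameTime t m
  reach-meets-time {x} p le₁ le₂ with m≤n⇒m<n∨m≡n le₁
  ... | inj₂ eq = x , ε , p , same-time (sym eq)
  reach-meets-time ε le₁ le₂ | inj₁ lt = ⊥-elim (<-irrefl refl (<-≤-trans lt le₂))
  reach-meets-time {st ra ca _} {t = st rt ct _} (_◅_ {j = st ra′ ca′ _} s p) le₁ le₂ | inj₁ lt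
    with reach-meets-time p (unshift-≤ ra ca ra′ ca′ rt ct (time-step s) lt) le₂
  ... | m , p₁ , p₂ , h = m , s ◅ p₁ , p₂ , h

  top-slot-least : ∀ u rm cm dm → suc cm ≡ rm + suc u → 1 ≤ rm → ¬ (dm ≡ inN × rm ≡ 1) →
                   slot (top u) < slot (st rm cm dm)
  top-slot-least u (suc zero) cm inN h o ng = ⊥-elim (ng (refl , refl))
  top-slot-least u (suc zero) cm inE h o ng with suc-injective h
  ... | refl = ≤-refl
  top-slot-least u (suc (suc k)) cm dm h o ng =
    ≤-trans (n≤1+n _) (≤-trans (double-< u<cm) (slot-lower (st _ cm dm)))
    where
    u<cm : suc u < cm
    u<cm = subst (suc u <_) (sym (suc-injective h)) (s≤s (m≤n+m (suc u) k))

  single-crossing-reverses-exits :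
    ∀ u v {wu wv s₀} → u < v → Reach F (top u) (st wu 0 inE) → Reach F (top v) (st wv 0 inE) →
    CrossAt F u v s₀ → (∀ s s′ → CrossAt F u v s → CrossAt F u v s′ → s ≡ s′) → wv < wu
  single-crossing-reverses-exits u v {s₀ = r₀ , zero} u<v eu ev (inj₁ (e , pu , pv)) once
    with top-inN-col-pos pu
  ... | ()
  -- u passes vertically: just after the cross v is West of u, and a second crossing would lie further West.
  single-crossing-reverses-exits u v {s₀ = r₀ , suc c} u<v eu ev (inj₁ (e , pu , pv)) once
    with ordered-until-exit v u pv′ pu′ (reach-exit-from pv′ ev) (reach-exit-from pu′ eu)
           (same-time (+-suc r₀ c)) (s≤s (≤-reflexive (sym (+-suc c c))))
    where
    pv′ = pv ◅◅ (crE e ◅ ε)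
    pu′ = pu ◅◅ (crN e ◅ ε)
  ... | inj₁ z = z
  ... | inj₂ (r₂ , c₂ , cr₂ , q) with once (r₀ , suc c) (r₂ , c₂) (inj₁ (e , pu , pv)) (inj₂ cr₂)
  ...   | refl = ⊥-elim (<-irrefl refl (col-antitone q))
  -- v passes vertically: starting East of u, v must first cross u with u vertical.
  single-crossing-reverses-exits u v {s₀ = r₀ , c₀} u<v eu ev (inj₂ (e , pv , pu)) once
    with reach-meets-time {t = top u} pv (s≤s (s≤s (<⇒≤ u<v))) (time-mono pu)
  ... | st rm cm dm , tm , mv , same-time hm
    with ordered-until u v ε tm pu mv (same-time hm) (same-time refl) (top-slot-least u rm cm dm hm (row-mono tm) not-top)
    where
    not-top : ¬ (dm ≡ inN × rm ≡ 1)
    not-top (d , r) = <-irrefl (sym (suc-injective (trans (cong col (same-row-inN tm (sym r) d))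
                                    (suc-injective (trans hm (cong (_+ suc u) r)))))) u<v
  ... | inj₁ z = ⊥-elim (<-irrefl refl (<-trans (n<1+n _) z))
  ... | inj₂ (r₁ , c₁ , cr₁) with once (r₁ , c₁) (r₀ , c₀) (inj₁ cr₁) (inj₂ (e , pv , pu))
  ...   | refl = ⊥-elim (inN≢inE (same-square-same-dir (proj₁ (proj₂ cr₁)) pu))

crossing-from-meeting : ∀ {F p q r c dp dq} → dp ≢ dq → F r c ≡ cross →
                        Reach F (top p) (st r c dp) → Reach F (top q) (st r c dq) → CrossAt F p q (r , c)
crossing-from-meeting {dp = inN} {inN} ne e p q = ⊥-elim (ne refl)
crossing-from-meeting {dp = inN} {inE} ne e p q = inj₁ (e , p , q)
crossing-from-meeting {dp = inE} {inN} ne e p q = inj₂ (e , q , p)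
crossing-from-meeting {dp = inE} {inE} ne e p q = ⊥-elim (ne refl)

CrossAt-sym : ∀ {F p q s} → CrossAt F p q s → CrossAt F q p s
CrossAt-sym (inj₁ x) = inj₂ x
CrossAt-sym (inj₂ x) = inj₁ x

module Hole (D : Filling) (a b′ : ℕ) (hole : D a (suc b′) ≡ empty) where

  b : ℕ
  b = suc b′

  U : Tile → Filling
  U t = update D a b t

  AtHole : ℕ → ℕ → Set
  AtHole r c = r ≡ a × c ≡ b

  hole-state : Dir → State
  hole-state = st a b

  update-elsewhere : ∀ t r c → ¬ AtHole r c → U t r c ≡ D r c
  update-elsewhere t r c ne with r ≡ᵇ a in e₁ | c ≡ᵇ b in e₂
  ... | false | _ = refl
  ... | true | false = refl
  ... | true | true = ⊥-elim (ne (≡ᵇ⇒≡ r a (subst T (sym e₁) tt) , ≡ᵇ⇒≡ c b (subst T (sym e₂) tt)))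

  update-here : ∀ t → U t a b ≡ t
  update-here t with a ≡ᵇ a in e₁ | b ≡ᵇ b in e₂
  ... | true | true = refl
  ... | false | _ = ⊥-elim (subst T e₁ (≡⇒≡ᵇ a a refl))
  ... | true | false = ⊥-elim (subst T e₂ (≡⇒≡ᵇ b b refl))

  retile : ∀ t t′ {r c x} → ¬ AtHole r c → U t r c ≡ x → U t′ r c ≡ x
  retile t t′ {r} {c} ne e = trans (update-elsewhere t′ r c ne) (trans (sym (update-elsewhere t r c ne)) e)

  AtHole? : ∀ r c → AtHole r c ⊎ ¬ AtHole r c
  AtHole? r c with r ≟ a | c ≟ b
  ... | yes e₁ | yes e₂ = inj₁ (e₁ , e₂)
  ... | no n₁ | _ = inj₂ (λ z → n₁ (proj₁ z))
  ... | yes _ | no n₂ = inj₂ (λ z → n₂ (proj₂ z))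

  filled-off-hole : ∀ {r c t} → D r c ≡ t → t ≢ empty → ¬ AtHole r c
  filled-off-hole e ne (refl , refl) = ne (trans (sym e) hole)

  step-lift : ∀ t {x y} → Step D x y → Step (U t) x y
  step-lift t (elN {r} {c} e) = elN (trans (update-elsewhere t r (suc c) (filled-off-hole e elbow≢empty)) e)
  step-lift t (elE {r} {c} e) = elE (trans (update-elsewhere t r (suc c) (filled-off-hole e elbow≢empty)) e)
  step-lift t (crN {r} {c} e) = crN (trans (update-elsewhere t r (suc c) (filled-off-hole e cross≢empty)) e)
  step-lift t (crE {r} {c} e) = crE (trans (update-elsewhere t r (suc c) (filled-off-hole e cross≢empty)) e)

  reach-lift : ∀ t {x y} → Reach D x y → Reach (U t) x y
  reach-lift t ε = ε
  reach-lift t (s ◅ p) = step-lift t s ◅ reach-lift t p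

  step-lower : ∀ t {r c d y} → Step (U t) (st r c d) y → ¬ AtHole r c → Step D (st r c d) y
  step-lower t (elN {r} {c} e) na = elN (trans (sym (update-elsewhere t r (suc c) na)) e)
  step-lower t (elE {r} {c} e) na = elE (trans (sym (update-elsewhere t r (suc c) na)) e)
  step-lower t (crN {r} {c} e) na = crN (trans (sym (update-elsewhere t r (suc c) na)) e)
  step-lower t (crE {r} {c} e) na = crE (trans (sym (update-elsewhere t r (suc c) na)) e)

  hole-final : ∀ {d y} → Reach D (hole-state d) y → y ≡ hole-state d
  hole-final ε = refl
  hole-final (elN e ◅ _) = ⊥-elim (elbow≢empty (trans (sym e) hole))
  hole-final (elE e ◅ _) = ⊥-elim (elbow≢empty (trans (sym e) hole))
  hole-final (crN e ◅ _) = ⊥-elim (cross≢empty (trans (sym e) hole))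
  hole-final (crE e ◅ _) = ⊥-elim (cross≢empty (trans (sym e) hole))

  reach-hole-once : ∀ {s} → Reach D s (hole-state inN) → Reach D s (hole-state inE) → ⊥
  reach-hole-once p q with Geometry.reach-total D p q
  ... | inj₁ z with hole-final z
  ...   | ()
  reach-hole-once p q | inj₂ z with hole-final z
  ...   | ()

  reach-hole-from : ∀ {s r c d′ d} → Reach D s (st r c d′) → Reach D s (hole-state d) → ¬ AtHole r c →
                    Reach D (st r c d′) (hole-state d)
  reach-hole-from p q na with Geometry.reach-total D p q
  ... | inj₁ z = z
  ... | inj₂ z with hole-final z
  ...   | refl = ⊥-elim (na (refl , refl))

  exit-avoids-hole : ∀ {s w d} → Reach D s (st w 0 inE) → Reach D s (hole-state d) → ⊥
  exit-avoids-hole p q with Geometry.reach-total D p q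
  ... | inj₁ z with Geometry.exit-final D z
  ...   | ()
  exit-avoids-hole p q | inj₂ z with hole-final z
  ...   | ()

  -- Pipes only move South and West, so once past the hole they never return to it.
  PastHole : State → Set
  PastHole x = a < row x ⊎ col x < b

  past-not-hole : ∀ {r c} → a < r ⊎ c < b → ¬ AtHole r c
  past-not-hole (inj₁ lt) (e , _) = <-irrefl (sym e) lt
  past-not-hole (inj₂ lt) (_ , e) = <-irrefl e lt

  past-reach : ∀ {F x y} → PastHole x → Reach F x y → PastHole y
  past-reach h ε = h
  past-reach {F} (inj₁ lt) (s ◅ p) = past-reach (inj₁ (≤-trans lt (Geometry.row-mono F (s ◅ ε)))) p
  past-reach {F} (inj₂ lt) (s ◅ p) = past-reach (inj₂ (≤-<-trans (Geometry.col-antitone F (s ◅ ε)) lt)) p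

  past-lower : ∀ t {x y} → PastHole x → Reach (U t) x y → Reach D x y
  past-lower t h ε = ε
  past-lower t {st r c d} h (s ◅ p) = step-lower t s (past-not-hole h) ◅ past-lower t (past-reach {U t} h (s ◅ ε)) p

  leave-hole-past : ∀ {F d z} → Step F (hole-state d) z → PastHole z
  leave-hole-past {F} s with Geometry.step-advances F s
  ... | inj₁ (lt , _) = inj₁ lt
  ... | inj₂ (_ , lt) = inj₂ lt

  ThroughHole : Tile → State → State → Set
  ThroughHole t x y = ∃[ d ] Reach D x (hole-state d) × ∃[ z ] Step (U t) (hole-state d) z × Reach D z y

  reach-split-at-hole : ∀ t {x y} → Reach (U t) x y → Reach D x y ⊎ ThroughHole t x y
  reach-split-at-hole t ε = inj₁ ε
  reach-split-at-hole t {st r c d} (s ◅ p) with AtHole? r c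
  ... | inj₁ (refl , refl) = inj₂ (d , ε , _ , s , past-lower t (leave-hole-past s) p)
  ... | inj₂ na with reach-split-at-hole t p
  ...   | inj₁ q = inj₁ (step-lower t s na ◅ q)
  ...   | inj₂ (d′ , q , z , s′ , q′) = inj₂ (d′ , step-lower t s na ◅ q , z , s′ , q′)

  reach-hole-lower : ∀ t {x d} → Reach (U t) x (hole-state d) → Reach D x (hole-state d)
  reach-hole-lower t q with reach-split-at-hole t q
  ... | inj₁ r = r
  ... | inj₂ (_ , _ , _ , s , q′) = ⊥-elim (past-not-hole (past-reach (leave-hole-past s) q′) (refl , refl))

  exiting-lower : ∀ t {q w y} → Reach D (top q) (st w 0 inE) → Reach (U t) (top q) y → Reach D (top q) y
  exiting-lower t ex p with reach-split-at-hole t p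
  ... | inj₁ r = r
  ... | inj₂ (_ , q₁ , _) = ⊥-elim (exit-avoids-hole ex q₁)

  reach-from-hole : ∀ t {d w} → Reach (U t) (hole-state d) w →
                    w ≡ hole-state d ⊎ ∃[ z ] Step (U t) (hole-state d) z × Reach D z w
  reach-from-hole t ε = inj₁ refl
  reach-from-hole t (s ◅ p) = inj₂ (_ , s , past-lower t (leave-hole-past s) p)

  west-exit south-exit : State
  west-exit = st a b′ inE
  south-exit = st (suc a) b inN

  exit-N exit-E : Tile → State
  exit-N elbow = west-exit
  exit-N _ = south-exit
  exit-E elbow = south-exit
  exit-E _ = west-exit

  leave-hole-N : ∀ t {z} → Step (U t) (hole-state inN) z → z ≡ exit-N t
  leave-hole-N elbow (elN e) = refl
  leave-hole-N elbow (crN e) = ⊥-elim (elbow≢cross (trans (sym (update-here elbow)) e))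
  leave-hole-N cross (elN e) = ⊥-elim (elbow≢cross (trans (sym e) (update-here cross)))
  leave-hole-N cross (crN e) = refl
  leave-hole-N empty (elN e) = ⊥-elim (elbow≢empty (trans (sym e) (update-here empty)))
  leave-hole-N empty (crN e) = ⊥-elim (cross≢empty (trans (sym e) (update-here empty)))

  leave-hole-E : ∀ t {z} → Step (U t) (hole-state inE) z → z ≡ exit-E t
  leave-hole-E elbow (elE e) = refl
  leave-hole-E elbow (crE e) = ⊥-elim (elbow≢cross (trans (sym (update-here elbow)) e))
  leave-hole-E cross (elE e) = ⊥-elim (elbow≢cross (trans (sym e) (update-here cross)))
  leave-hole-E cross (crE e) = refl
  leave-hole-E empty (elE e) = ⊥-elim (elbow≢empty (trans (sym e) (update-here empty)))
  leave-hole-E empty (crE e) = ⊥-elim (cross≢empty (trans (sym e) (update-here empty)))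

  leave-hole-west-or-south : ∀ t {d z} → Step (U t) (hole-state d) z → z ≡ west-exit ⊎ z ≡ south-exit
  leave-hole-west-or-south elbow {inN} s rewrite leave-hole-N elbow s = inj₁ refl
  leave-hole-west-or-south cross {inN} s rewrite leave-hole-N cross s = inj₂ refl
  leave-hole-west-or-south empty {inN} s rewrite leave-hole-N empty s = inj₂ refl
  leave-hole-west-or-south elbow {inE} s rewrite leave-hole-E elbow s = inj₂ refl
  leave-hole-west-or-south cross {inE} s rewrite leave-hole-E cross s = inj₁ refl
  leave-hole-west-or-south empty {inE} s rewrite leave-hole-E empty s = inj₁ refl

  data Route (t : Tile) (p : ℕ) (x : State) : Set where
    direct : Reach D (top p) x → Route t p x
    via-N : Reach D (top p) (hole-state inN) → Reach D (exit-N t) x → Route t p x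
    via-E : Reach D (top p) (hole-state inE) → Reach D (exit-E t) x → Route t p x

  route : ∀ t {p x} → Reach (U t) (top p) x → Route t p x
  route t q with reach-split-at-hole t q
  ... | inj₁ r = direct r
  ... | inj₂ (inN , q₁ , _ , s , q₂) with leave-hole-N t s
  ...   | refl = via-N q₁ q₂
  route t q | inj₂ (inE , q₁ , _ , s , q₂) with leave-hole-E t s
  ...   | refl = via-E q₁ q₂

module Configuration (D : Filling) (a′ b′ : ℕ)
  (hole : D (suc a′) (suc b′) ≡ empty)
  (only-hole : ∀ r c → 1 ≤ r → 1 ≤ c → D r c ≡ empty → r ≡ suc a′ × c ≡ suc b′)
  (n : ℕ) (bounded : ∀ r c → 1 ≤ r → 1 ≤ c → D r c ≡ cross → r < n × c < n)
  (hyp1 : Hyp1 D (suc a′) (suc b′)) where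

  a : ℕ
  a = suc a′

  open Hole D a b′ hole
  open Geometry D
  open Tracing D n bounded

  Ends : State → Set
  Ends y = (∃[ w ] y ≡ st w 0 inE) ⊎ (∃[ d ] y ≡ hole-state d)

  stuck-ends : ∀ {y} → Stuck y → Ends y
  stuck-ends (inj₁ ex) = inj₁ ex
  stuck-ends (inj₂ (r , c , d , refl , o₁ , o₂ , e)) with only-hole r c o₁ o₂ e
  ... | refl , refl = inj₂ (d , refl)

  E-source : ∃[ k ] Reach D (top k) (hole-state inE)
  E-source with Backwards.trace-back-E b a′ b n ≤-refl (m≤n+m n b)
  ... | inj₁ z = z
  ... | inj₂ (r , c , b<c , o₁ , o₂ , e) with only-hole r c o₁ o₂ e
  ...   | _ , refl = ⊥-elim (<-irrefl refl b<c)

  S-exit : ∃[ w ] Reach D south-exit (st w 0 inE)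
  S-exit with trace-N (suc a) b′ n (s≤s z≤n) (m≤n+m n (suc a))
  ... | y , p , s with stuck-ends s
  ...   | inj₁ (w , refl) = w , p
  ...   | inj₂ (_ , refl) = ⊥-elim (<-irrefl refl (row-mono p))

  E-segment-east : ∀ {r c d} → Reach D (st r c d) (hole-state inE) → ¬ AtHole r c → b < c
  E-segment-east p ne with m≤n⇒m<n∨m≡n (col-antitone p)
  ... | inj₁ lt = lt
  ... | inj₂ eq with reach-same-col p (sym eq)
  ...   | inj₁ e = ⊥-elim (ne (cong row e , sym eq))
  ...   | inj₂ ()

  E-passes : ∀ {k r c} → Reach D (top k) (st r c inN) → Reach D (st r c inN) (hole-state inE) → OnE D a b r c
  E-passes p₁ p₂ = _ , inN , p₁ , p₂ , λ { (refl , refl) → inN≢inE (sym (cong dir (hole-final p₂))) }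

  E-meets-row : ∀ r → 1 ≤ r → r ≤ a → ∃[ c ] OnE D a b r c
  E-meets-row r o le with m≤n⇒m<n∨m≡n o
  ... | inj₂ refl = _ , E-passes ε (proj₂ E-source)
  ... | inj₁ 1<r with reach-enters-row r (proj₂ E-source) 1<r le
  ...   | st _ c _ , p₁ , p₂ , refl , refl = c , E-passes p₁ p₂

  rectangle-crosses : ∀ r c → 1 ≤ r → r ≤ a → 1 ≤ c → c ≤ b → ¬ AtHole r c → D r c ≡ cross
  rectangle-crosses r c o r≤a o′ c≤b =
    hyp1 r c (o′ , E-meets-row r o r≤a , λ { c′ (_ , _ , _ , p , ne) → ≤-<-trans c≤b (E-segment-east p ne) })

  cross-row-above : ∀ {r} → 1 ≤ r → r < a → CrossRow r b
  cross-row-above o r<a j o′ j≤b = rectangle-crosses _ j o (<⇒≤ r<a) o′ j≤b (λ z → <-irrefl (proj₁ z) r<a)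

  cross-row-hole : CrossRow a b′
  cross-row-hole j o j≤b′ =
    rectangle-crosses a j (s≤s z≤n) ≤-refl o (m≤n⇒m≤1+n j≤b′) (λ z → <-irrefl (proj₂ z) (s≤s j≤b′))

  cross-row-above-U : ∀ t {r} → 1 ≤ r → r < a → Geometry.CrossRow (U t) r b
  cross-row-above-U t o r<a j o′ j≤b =
    trans (update-elsewhere t _ j (λ z → <-irrefl (proj₁ z) r<a)) (cross-row-above o r<a j o′ j≤b)

  N-column : ∀ r → 1 ≤ r → r ≤ a → Reach D (top b′) (st r b inN)
  N-column (suc zero) _ _ = ε
  N-column (suc (suc r)) _ le =
    N-column (suc r) (s≤s z≤n) (≤-trans (n≤1+n _) le) ◅◅
    (crN (cross-row-above (s≤s z≤n) le b (s≤s z≤n) ≤-refl) ◅ ε)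

  N-segment : Reach D (top b′) (hole-state inN)
  N-segment = N-column a (s≤s z≤n) ≤-refl

  W-segment : Reach D west-exit (st a 0 inE)
  W-segment = go b′ ≤-refl
    where
    go : ∀ j → j ≤ b′ → Reach D (st a j inE) (st a 0 inE)
    go zero _ = ε
    go (suc j) le = crE (cross-row-hole (suc j) (s≤s z≤n) le) ◅ go j (≤-trans (n≤1+n _) le)

  W-straight : ∀ {y} → Reach D west-exit y → ∃[ j ] y ≡ st a j inE
  W-straight = cross-row-straight cross-row-hole

  not-from-E-in-col-b : ∀ {r} → 1 ≤ r → ¬ Reach D (st r b inE) (hole-state inN)
  not-from-E-in-col-b {r} o (elE e ◅ p) with <-cmp r a
  ... | tri< r<a _ _ = elbow≢cross (trans (sym e) (cross-row-above o r<a b (s≤s z≤n) ≤-refl))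
  ... | tri≈ _ refl _ = elbow≢empty (trans (sym e) hole)
  ... | tri> _ _ r>a = <-irrefl refl (<-trans (n<1+n r) (≤-<-trans (row-mono p) r>a))
  not-from-E-in-col-b o (crE e ◅ p) = <-irrefl refl (col-antitone p)

  N-segment-shape : ∀ {x} → 1 ≤ row x → Reach D x (hole-state inN) →
                    x ≡ hole-state inN ⊎ ∃[ r ] x ≡ st r b inN × r < a
  N-segment-shape {st r c d} o p with m≤n⇒m<n∨m≡n (col-antitone p)
  ... | inj₁ b<c with reach-crosses-col b p ≤-refl b<c
  ...   | r₁ , p₁ , p₂ = ⊥-elim (not-from-E-in-col-b (≤-trans o (row-mono p₁)) p₂)
  N-segment-shape {st r c inE} o p | inj₂ refl = ⊥-elim (not-from-E-in-col-b o p)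
  N-segment-shape {st r c inN} o p | inj₂ refl with m≤n⇒m<n∨m≡n (row-mono p)
  ... | inj₁ r<a = inj₂ (r , refl , r<a)
  ... | inj₂ refl = inj₁ refl

  after-hole-shape : ∀ {z w} → z ≡ west-exit ⊎ z ≡ south-exit → Reach D z w →
                     a < row w ⊎ ∃[ j ] w ≡ st a j inE × j ≤ b′
  after-hole-shape (inj₁ refl) q with W-straight q
  ... | j , refl = inj₂ (j , refl , col-antitone q)
  after-hole-shape (inj₂ refl) q = inj₁ (row-mono q)

  -- Getting there means crossing column b either in a row of crosses above the hole or through the hole.
  no-return-west-of-hole : ∀ t {y c} → Reach (U t) y (st a c inN) → b < col y → c < b → 1 ≤ row y → ⊥
  no-return-west-of-hole t q b<y c<b o with reach-split-at-hole t q
  ... | inj₂ (_ , _ , _ , s , q₂) with after-hole-shape (leave-hole-west-or-south t s) q₂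
  ...   | inj₁ lt = <-irrefl refl lt
  ...   | inj₂ (_ , () , _)
  no-return-west-of-hole t q b<y c<b o | inj₁ qD with reach-crosses-col b qD (<⇒≤ c<b) b<y
  ... | r₁ , q₁ , q₂ with <-cmp r₁ a
  ...   | tri< r₁<a _ _ with cross-row-straight (cross-row-above (≤-trans o (row-mono q₁)) r₁<a) q₂
  ...     | _ , ()
  no-return-west-of-hole t q b<y c<b o | inj₁ qD | r₁ , q₁ , q₂ | tri≈ _ refl _ with hole-final q₂
  ... | ()
  no-return-west-of-hole t q b<y c<b o | inj₁ qD | r₁ , q₁ , q₂ | tri> _ _ r₁>a =
    <-irrefl refl (<-≤-trans r₁>a (row-mono q₂))

  meets-N-stays-above : ∀ t {p q r c dp dq w} → ¬ AtHole r c → dp ≢ dq → Reach D (top p) (st r c dp) →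
                        Reach (U t) (top q) (st r c dq) → Reach D (top p) (hole-state inN) →
                        Reach (U t) (top q) w → ¬ (a ≤ row w)
  meets-N-stays-above t {dp = dp} {dq} ne dd rp rq pN rw aw with N-segment-shape (row-mono rp) (reach-hole-from rp pN ne)
  ... | inj₁ e = ne (cong row e , cong col e)
  meets-N-stays-above t {dp = inN} {inN} ne dd rp rq pN rw aw | inj₂ (_ , refl , _) = dd refl
  meets-N-stays-above t {dp = inN} {inE} ne dd rp rq pN rw aw | inj₂ (_ , refl , r<a) =
    Geometry.cross-row-no-descent (U t) (cross-row-above-U t (row-mono rp) r<a) rq rw (<-≤-trans r<a aw)

  filled : ∀ t → t ≢ empty → ∀ r c → 1 ≤ r → 1 ≤ c → U t r c ≢ empty
  filled t t≢empty r c o₁ o₂ e with AtHole? r c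
  ... | inj₁ (refl , refl) = t≢empty (trans (sym (update-here t)) e)
  ... | inj₂ ne = ne (only-hole r c o₁ o₂ (trans (sym (update-elsewhere t r c ne)) e))

  finitely-many-crosses : ∀ t → FinitelyManyCrosses (U t)
  finitely-many-crosses t = n + suc (a + b) , bound
    where
    bound : ∀ r c → 1 ≤ r → 1 ≤ c → U t r c ≡ cross → r < n + suc (a + b) × c < n + suc (a + b)
    bound r c o₁ o₂ e with AtHole? r c
    ... | inj₁ (refl , refl) = ≤-trans (s≤s (m≤m+n a b)) (m≤n+m _ n) , ≤-trans (s≤s (m≤n+m b a)) (m≤n+m _ n)
    ... | inj₂ ne with bounded r c o₁ o₂ (trans (sym (update-elsewhere t r c ne)) e)
    ...   | r<n , c<n = ≤-trans r<n (m≤m+n n _) , ≤-trans c<n (m≤m+n n _)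

  meets-N-and-E : ∀ {p q r c dp dq} → ¬ AtHole r c → dp ≢ dq →
                  Reach D (top p) (hole-state inN) → Reach D (top q) (hole-state inE) →
                  Reach (U cross) (top p) (st r c dp) → Reach (U cross) (top q) (st r c dq) → ⊥
  meets-N-and-E ne dd pN qE rp rq with route cross rp
  ... | direct r = meets-N-stays-above cross ne dd r rq pN (reach-lift cross qE) ≤-refl
  ... | via-E pE _ = reach-hole-once pN pE
  ... | via-N _ pS with route cross rq
  ...   | direct r′ = <-irrefl refl (<-≤-trans (row-mono pS) (row-mono (reach-hole-from r′ qE ne)))
  ...   | via-N qN _ = reach-hole-once qN qE
  ...   | via-E _ qW with W-straight qW
  ...     | _ , refl = <-irrefl refl (row-mono pS)

  crossing-at-hole-is-only : ∀ {p q r c} → CrossAt (U cross) p q (a , b) → ¬ AtHole r c →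
                             ¬ CrossAt (U cross) p q (r , c)
  crossing-at-hole-is-only (inj₁ (_ , pN , qE)) ne (inj₁ (_ , rp , rq)) =
    meets-N-and-E ne inN≢inE (reach-hole-lower cross pN) (reach-hole-lower cross qE) rp rq
  crossing-at-hole-is-only (inj₁ (_ , pN , qE)) ne (inj₂ (_ , rq , rp)) =
    meets-N-and-E ne (λ e → inN≢inE (sym e)) (reach-hole-lower cross pN) (reach-hole-lower cross qE) rp rq
  crossing-at-hole-is-only (inj₂ (_ , qN , pE)) ne (inj₁ (_ , rp , rq)) =
    meets-N-and-E ne (λ e → inN≢inE (sym e)) (reach-hole-lower cross qN) (reach-hole-lower cross pE) rq rp
  crossing-at-hole-is-only (inj₂ (_ , qN , pE)) ne (inj₂ (_ , rq , rp)) =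
    meets-N-and-E ne inN≢inE (reach-hole-lower cross qN) (reach-hole-lower cross pE) rq rp

  data Part : Set where
    before after-N after-E : Part

  part : ∀ {t p x} → Route t p x → Part
  part (direct _) = before
  part (via-N _ _) = after-N
  part (via-E _ _) = after-E

  -- Swapping the tile at the hole exchanges the continuations of the N and E segments:
  -- what follows N in one filling follows E in the other, and conversely.
  label : ℕ → Part → ℕ
  label p before = p
  label p after-N = proj₁ E-source
  label p after-E = b′

  relabel-elbow : ∀ {p x} (ρ : Route elbow p x) → Reach (U cross) (top (label p (part ρ))) x
  relabel-elbow (direct r) = reach-lift cross r
  relabel-elbow (via-N _ q) = reach-lift cross (proj₂ E-source) ◅◅ (crE (update-here cross) ◅ reach-lift cross q)
  relabel-elbow (via-E _ q) = reach-lift cross N-segment ◅◅ (crN (update-here cross) ◅ reach-lift cross q)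

  relabel-cross : ∀ {p x} (ρ : Route cross p x) → Reach (U elbow) (top (label p (part ρ))) x
  relabel-cross (direct r) = reach-lift elbow r
  relabel-cross (via-N _ q) = reach-lift elbow (proj₂ E-source) ◅◅ (elE (update-here elbow) ◅ reach-lift elbow q)
  relabel-cross (via-E _ q) = reach-lift elbow N-segment ◅◅ (elN (update-here elbow) ◅ reach-lift elbow q)

  ViaHole : Tile → ℕ → State → Set
  ViaHole t p x = (Reach D (top p) (hole-state inN) × Reach D (exit-N t) x) ⊎
                  (Reach D (top p) (hole-state inE) × Reach D (exit-E t) x)

  NoMixedMeetings : Tile → Set
  NoMixedMeetings t = ∀ {p q r c dp dq r′ c′ dp′ dq′} →
    ¬ AtHole r c → ¬ AtHole r′ c′ → dp ≢ dq → dp′ ≢ dq′ →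
    U t r c ≡ cross → U t r′ c′ ≡ cross →
    Reach D (top p) (st r c dp) → Reach (U t) (top q) (st r c dq) →
    ViaHole t p (st r′ c′ dp′) → Reach (U t) (top q) (st r′ c′ dq′) → ⊥

  no-mixed-meetings-cross : NoMixedMeetings cross
  no-mixed-meetings-cross ne ne′ dd dd′ _ _ rp rq (inj₁ (pN , pS)) rq′ =
    meets-N-stays-above cross ne dd rp rq pN rq′ (≤-trans (n≤1+n a) (row-mono pS))
  no-mixed-meetings-cross {dq′ = dq′} ne ne′ dd dd′ _ _ rp rq (inj₂ (pE , pW)) rq′ with W-straight pW
  ... | j , refl with dq′
  ...   | inE = dd′ refl
  ...   | inN with Geometry.reach-total (U cross) rq rq′
  ...     | inj₁ z = no-return-west-of-hole cross z (E-segment-east (reach-hole-from rp pE ne) ne)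
                       (s≤s (col-antitone pW)) (row-mono rp)
  ...     | inj₂ z = <-irrefl refl (≤-<-trans (Geometry.col-antitone (U cross) z)
                       (≤-<-trans (col-antitone pW) (<-trans (n<1+n b′) (E-segment-east (reach-hole-from rp pE ne) ne))))

  module UnderHyp2 (once : ∀ p q s s′ → CrossAt (U cross) p q s → CrossAt (U cross) p q s′ → s ≡ s′)
                   (hyp2 : Hyp2 D a b) where
    open Timing (U cross) using (single-crossing-reverses-exits)

    NS-pipe : Reach (U cross) (top b′) south-exit
    NS-pipe = reach-lift cross N-segment ◅◅ (crN (update-here cross) ◅ ε)

    NS-exit : Reach (U cross) (top b′) (st (proj₁ S-exit) 0 inE)
    NS-exit = NS-pipe ◅◅ reach-lift cross (proj₂ S-exit)

    EW-exit : ∀ {p} → Reach D (top p) (hole-state inE) → Reach (U cross) (top p) (st a 0 inE)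
    EW-exit pE = reach-lift cross pE ◅◅ (crE (update-here cross) ◅ reach-lift cross W-segment)

    -- In U cross the old pipe q crosses the pipes EW and NS once each, so the order of exits is
    -- reversed both times: q starts between N and E and ends between W and S, excluded by (2).
    old-pipe-misses-E-or-S :
      ∀ {p q r c dp dq r′ c′ dp′ dq′ w} → ¬ AtHole r c → ¬ AtHole r′ c′ → dp ≢ dq → dp′ ≢ dq′ →
      U elbow r c ≡ cross → U elbow r′ c′ ≡ cross →
      Reach D (top p) (st r c dp) → Reach (U elbow) (top q) (st r c dq) → Reach D (top p) (hole-state inE) →
      Reach D south-exit (st r′ c′ dp′) → Reach (U elbow) (top q) (st r′ c′ dq′) →
      Reach D (top q) (st w 0 inE) → ⊥
    old-pipe-misses-E-or-S {p} {q} {r} {c} {dq = dq} {r′} {c′} {dq′ = dq′} {w}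
                           ne ne′ dd dd′ e e′ rp rq pE pS rq′ qX =
      hyp2 b (suc p) a (proj₁ S-exit) q w N-segment pE W-segment (proj₂ S-exit) qX
           (inj₁ (b<q , s≤s q<p)) (inj₁ (a<w , w<wS))
      where
      qD : Reach D (top q) (st r c dq)
      qD = exiting-lower elbow qX rq
      qD′ : Reach D (top q) (st r′ c′ dq′)
      qD′ = exiting-lower elbow qX rq′

      q-crosses-EW : CrossAt (U cross) q p (r , c)
      q-crosses-EW = crossing-from-meeting (λ z → dd (sym z)) (retile elbow cross ne e)
                       (reach-lift cross qD) (reach-lift cross rp)
      NS-crosses-q : CrossAt (U cross) b′ q (r′ , c′)
      NS-crosses-q = crossing-from-meeting dd′ (retile elbow cross ne′ e′)
                       (NS-pipe ◅◅ reach-lift cross pS) (reach-lift cross qD′)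

      a<w : a < w
      a<w = <-≤-trans (row-mono pS) (row-mono (reach-exit-from qD′ qX))
      b<q : b < suc q
      b<q = <-≤-trans (E-segment-east (reach-hole-from rp pE ne) ne) (col-antitone qD)
      q<p : q < p
      q<p with <-cmp q p
      ... | tri< lt _ _ = lt
      ... | tri≈ _ refl _ = ⊥-elim (exit-avoids-hole qX pE)
      ... | tri> _ _ gt = ⊥-elim (<-asym a<w
              (single-crossing-reverses-exits p q gt (EW-exit pE) (reach-lift cross qX) (CrossAt-sym q-crosses-EW) (once p q)))
      w<wS : w < proj₁ S-exit
      w<wS = single-crossing-reverses-exits b′ q (≤-pred b<q) NS-exit (reach-lift cross qX) NS-crosses-q (once b′ q)

    N-pipe-misses-E : ∀ {p q r c dp dq} → ¬ AtHole r c →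
                      Reach D (top p) (st r c dp) → Reach D (top p) (hole-state inE) →
                      Reach (U elbow) (top q) (st r c dq) → Reach D (top q) (hole-state inN) → ⊥
    N-pipe-misses-E ne rp pE rq qN with Geometry.reach-total (U elbow) (reach-lift elbow qN) rq
    ... | inj₁ z with reach-from-hole elbow z
    ...   | inj₁ e = ne (cong row e , cong col e)
    ...   | inj₂ (_ , s , q) with after-hole-shape (leave-hole-west-or-south elbow s) q
    ...     | inj₁ a<r = <-irrefl refl (<-≤-trans a<r (row-mono (reach-hole-from rp pE ne)))
    ...     | inj₂ (_ , refl , j≤b′) = <-irrefl refl (<-trans (E-segment-east (reach-hole-from rp pE ne) ne) (s≤s j≤b′))
    N-pipe-misses-E ne rp pE rq qN | inj₂ z with N-segment-shape (Geometry.row-mono (U elbow) rq) (reach-hole-lower elbow z)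
    ... | inj₁ e = ne (cong row e , cong col e)
    ... | inj₂ (_ , refl , _) = <-irrefl refl (E-segment-east (reach-hole-from rp pE ne) ne)

    E-pipe-misses-S : ∀ {q r c dp dq} → dp ≢ dq → Reach D south-exit (st r c dp) →
                      Reach (U elbow) (top q) (st r c dq) → Reach D (top q) (hole-state inE) → ⊥
    E-pipe-misses-S dd pS rq qE with Geometry.reach-total (U elbow) (reach-lift elbow qE) rq
    ... | inj₂ z = <-irrefl refl (<-≤-trans (row-mono pS) (Geometry.row-mono (U elbow) z))
    ... | inj₁ z with reach-from-hole elbow z
    ...   | inj₁ e = <-irrefl (sym (cong row e)) (row-mono pS)
    ...   | inj₂ (_ , s , q) with leave-hole-E elbow s
    ...     | refl = dd (same-square-same-dir pS q)

    no-mixed-meetings-elbow : NoMixedMeetings elbow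
    no-mixed-meetings-elbow ne ne′ dd dd′ e e′ rp rq (inj₁ (pN , pW)) rq′ with W-straight pW
    ... | _ , refl = meets-N-stays-above elbow ne dd rp rq pN rq′ ≤-refl
    no-mixed-meetings-elbow {q = q} ne ne′ dd dd′ e e′ rp rq (inj₂ (pE , pS)) rq′ with trace-top q
    ... | _ , qy , s with stuck-ends s
    ...   | inj₁ (_ , refl) = old-pipe-misses-E-or-S ne ne′ dd dd′ e e′ rp rq pE pS rq′ qy
    ...   | inj₂ (inN , refl) = N-pipe-misses-E ne rp pE rq qy
    ...   | inj₂ (inE , refl) = E-pipe-misses-S dd′ pS rq′ qy

  data Meeting (t : Tile) (p q r c : ℕ) : Set where
    meeting : ∀ dp dq → dp ≢ dq → U t r c ≡ cross →
              Reach (U t) (top p) (st r c dp) → Reach (U t) (top q) (st r c dq) → Meeting t p q r c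

  meeting-from-crossing : ∀ {t p q r c} → CrossAt (U t) p q (r , c) → Meeting t p q r c
  meeting-from-crossing (inj₁ (e , pp , qq)) = meeting inN inE inN≢inE e pp qq
  meeting-from-crossing (inj₂ (e , qq , pp)) = meeting inE inN (λ z → inN≢inE (sym z)) e pp qq

  meeting-sym : ∀ {t p q r c} → Meeting t p q r c → Meeting t q p r c
  meeting-sym (meeting dp dq dd e pp qq) = meeting dq dp (λ z → dd (sym z)) e qq pp

  module Relabelling (t t′ : Tile) (no-mixed : NoMixedMeetings t)
    (relabel : ∀ {p x} (ρ : Route t p x) → Reach (U t′) (top (label p (part ρ))) x)
    (once : ∀ p q s s′ → CrossAt (U t′) p q s → CrossAt (U t′) p q s′ → s ≡ s′) where

    part-of : ∀ {p q r c} → Meeting t p q r c → Part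
    part-of (meeting _ _ _ _ pp _) = part (route t pp)

    part-consistent : ∀ {p q r c r′ c′} → ¬ AtHole r c → ¬ AtHole r′ c′ →
                      (m : Meeting t p q r c) (m′ : Meeting t p q r′ c′) → part-of m ≡ part-of m′
    part-consistent ne ne′ (meeting _ _ dd e pp qq) (meeting _ _ dd′ e′ pp′ qq′) with route t pp | route t pp′
    ... | direct _ | direct _ = refl
    ... | via-N _ _ | via-N _ _ = refl
    ... | via-E _ _ | via-E _ _ = refl
    ... | via-N pN _ | via-E pE _ = ⊥-elim (reach-hole-once pN pE)
    ... | via-E pE _ | via-N pN _ = ⊥-elim (reach-hole-once pN pE)
    ... | direct r | via-N pN x = ⊥-elim (no-mixed ne ne′ dd dd′ e e′ r qq (inj₁ (pN , x)) qq′)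
    ... | direct r | via-E pE x = ⊥-elim (no-mixed ne ne′ dd dd′ e e′ r qq (inj₂ (pE , x)) qq′)
    ... | via-N pN x | direct r = ⊥-elim (no-mixed ne′ ne dd′ dd e′ e r qq′ (inj₁ (pN , x)) qq)
    ... | via-E pE x | direct r = ⊥-elim (no-mixed ne′ ne dd′ dd e′ e r qq′ (inj₂ (pE , x)) qq)

    relabel-meeting : ∀ {p q r c} → ¬ AtHole r c → (m : Meeting t p q r c) →
                      CrossAt (U t′) (label p (part-of m)) (label q (part-of (meeting-sym m))) (r , c)
    relabel-meeting ne (meeting _ _ dd e pp qq) =
      crossing-from-meeting dd (retile t t′ ne e) (relabel (route t pp)) (relabel (route t qq))

    crossings-off-hole-unique : ∀ {p q r c r′ c′} → ¬ AtHole r c → ¬ AtHole r′ c′ →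
                                CrossAt (U t) p q (r , c) → CrossAt (U t) p q (r′ , c′) → (r , c) ≡ (r′ , c′)
    crossings-off-hole-unique {p} {q} {r′ = r′} {c′} ne ne′ x x′ =
      once _ _ _ _ (relabel-meeting ne m)
        (subst₂ (λ u v → CrossAt (U t′) (label p u) (label q v) (r′ , c′))
                (sym (part-consistent ne ne′ m m′))
                (sym (part-consistent ne ne′ (meeting-sym m) (meeting-sym m′)))
                (relabel-meeting ne′ m′))
      where
      m = meeting-from-crossing x
      m′ = meeting-from-crossing x′

  elbow-to-cross : PipeDream (U elbow) → PipeDream (U cross)
  elbow-to-cross (_ , _ , once) = filled cross (λ ()) , finitely-many-crosses cross , unique
    where
    open Relabelling cross elbow no-mixed-meetings-cross relabel-cross once
    unique : ∀ p q s s′ → CrossAt (U cross) p q s → CrossAt (U cross) p q s′ → s ≡ s′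
    unique p q (r , c) (r′ , c′) x x′ with AtHole? r c | AtHole? r′ c′
    ... | inj₁ (refl , refl) | inj₁ (refl , refl) = refl
    ... | inj₁ (refl , refl) | inj₂ ne′ = ⊥-elim (crossing-at-hole-is-only x ne′ x′)
    ... | inj₂ ne | inj₁ (refl , refl) = ⊥-elim (crossing-at-hole-is-only x′ ne x)
    ... | inj₂ ne | inj₂ ne′ = crossings-off-hole-unique ne ne′ x x′

  cross-to-elbow : Hyp2 D a b → PipeDream (U cross) → PipeDream (U elbow)
  cross-to-elbow hyp2 (_ , _ , once) = filled elbow (λ ()) , finitely-many-crosses elbow , unique
    where
    open Relabelling elbow cross (UnderHyp2.no-mixed-meetings-elbow once hyp2) relabel-elbow once
    no-crossing-at-hole : ∀ {p q} → ¬ CrossAt (U elbow) p q (a , b)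
    no-crossing-at-hole (inj₁ (e , _)) = elbow≢cross (trans (sym (update-here elbow)) e)
    no-crossing-at-hole (inj₂ (e , _)) = elbow≢cross (trans (sym (update-here elbow)) e)
    unique : ∀ p q s s′ → CrossAt (U elbow) p q s → CrossAt (U elbow) p q s′ → s ≡ s′
    unique p q (r , c) (r′ , c′) x x′ with AtHole? r c | AtHole? r′ c′
    ... | inj₁ (refl , refl) | _ = ⊥-elim (no-crossing-at-hole x)
    ... | inj₂ _ | inj₁ (refl , refl) = ⊥-elim (no-crossing-at-hole x′)
    ... | inj₂ ne | inj₂ ne′ = crossings-off-hole-unique ne ne′ x x′

lemma3p3 : (D : Filling) (a b : ℕ) → EmptyAt D a b → Hyp1 D a b →
    (PipeDream (update D a b elbow) → PipeDream (update D a b cross)) ×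
    (Hyp2 D a b → PipeDream (update D a b cross) → PipeDream (update D a b elbow))
lemma3p3 D zero b (() , _) hyp1
lemma3p3 D (suc a′) zero (_ , () , _) hyp1
lemma3p3 D (suc a′) (suc b′) (_ , _ , hole , only-hole , n , bounded) hyp1 = elbow-to-cross , cross-to-elbow
  where open Configuration D a′ b′ hole only-hole n bounded hyp1
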